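{- Let $\psi:\mathbb{N}\to\mathbb{N}$ be an injective function and let $A=\psi(\mathbb{N})$. Then for all $n\in\mathbb{N}$ and all integers $\alpha\ge 1$, \[ p^{A}_{\alpha}(n)=\sum_{i=0}^{n}p^{A}(n-i)\,\Gamma^{\psi}_{\alpha}(i), \] where $\Gamma^{\psi}_{\alpha}(0)=1$ and, for $m\ge 1$, \[ \Gamma^{\psi}_{\alpha}(m)=\sum_{(N_0,N_1,\dots)}\ \prod_{j\ge 0}\bar{p}^{A}(N_j), \] the sum running over all sequences $(N_0,N_1,\dots)$ of non-negative integers (all but finitely many $0$) with $m=(\alpha+1)\sum_{i\ge 0}2^{i}N_i$ (so $\Gamma^{\psi}_{\alpha}(m)=0$ if there is no such sequence, i.e. if $\alpha+1\nmid m$).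
   Context: Here $\mathbb{N}=\{0,1,2,\dots\}$. A partition of $n$ into elements of $A$ is a multiset of positive integers belonging to $A$ whose sum is $n$. $p^{A}(n)$ is the number of partitions of $n$ into elements of $A$ (no restriction on repetitions); $p^{A}_{\alpha}(n)$ is the number of such partitions in which each part occurs at most $\alpha$ times; $p^A(0)=p^A_\alpha(0)=1$. $\bar{p}^{A}(n)=E^{A}(n)-O^{A}(n)$, where $E^{A}(n)$ (resp. $O^{A}(n)$) is the number of partitions of $n$ into elements of $A$ (no restriction on repetitions) having an even (resp. odd) number of parts, and $\bar{p}^{A}(0)=1$. -}

module Defs where

open import Data.Nat using (ℕ; zero; suc; _+_; _*_; _∸_; _^_; _≤_; _≥_; _%_; _≟_)
open import Data.Integer using (ℤ; +_; _-_) renaming (_*_ to _*ℤ_; _+_ to _+ℤ_)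
open import Data.Nat.ListAction using (sum)
open import Data.List using (List; []; _∷_; length; filter; map; concatMap; upTo; foldr)
open import Data.List.Relation.Unary.All using (All)
open import Data.List.Relation.Unary.Linked using (Linked)
open import Data.Vec using (Vec; []; _∷_)
open import Data.Product using (Σ; ∃)
open import Relation.Binary.PropositionalEquality using (_≡_)
open import Relation.Nullary.Decidable using (⌊_⌋)
open import Data.Bool using (if_then_else_)
open import Data.Fin using (Fin)
open import Function.Bundles using (_↔_)

Img : (ℕ → ℕ) → ℕ → Set
Img ψ a = ∃ λ i → ψ i ≡ a

occ : ℕ → List ℕ → ℕ
occ a xs = length (filter (a ≟_) xs)

-- A partition of n into elements of A: a multiset of positive integers
-- in A with sum n, represented canonically as a non-increasing list.
record Partition (A : ℕ → Set) (n : ℕ) : Set where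
  constructor mkPartition
  field
    parts   : List ℕ
    nonincr : Linked _≥_ parts
    pos     : All (λ a → 1 ≤ a) parts
    inA     : All A parts
    total   : sum parts ≡ n
open Partition public

record PartitionAtMost (A : ℕ → Set) (α n : ℕ) : Set where
  constructor mkPartitionAtMost
  field
    partition : Partition A n
    mult      : All (λ a → occ a (parts partition) ≤ α) (parts partition)

record EvenPartition (A : ℕ → Set) (n : ℕ) : Set where
  field
    partition : Partition A n
    even      : length (parts partition) % 2 ≡ 0

record OddPartition (A : ℕ → Set) (n : ℕ) : Set where
  field
    partition : Partition A n
    odd       : length (parts partition) % 2 ≡ 1

HasCard : Set → ℕ → Set
HasCard X k = Fin k ↔ X

vecsUpTo : (len b : ℕ) → List (Vec ℕ len)
vecsUpTo zero    b = [] ∷ []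
vecsUpTo (suc l) b = concatMap (λ N → map (N ∷_) (vecsUpTo l b)) (upTo (suc b))

weight : ∀ {len} → Vec ℕ len → ℕ
weight []       = 0
weight (N ∷ Ns) = N + 2 * weight Ns

prodℤ : ∀ {len} → (ℕ → ℤ) → Vec ℕ len → ℤ
prodℤ f []       = + 1
prodℤ f (N ∷ Ns) = f N *ℤ prodℤ f Ns

sumℤ : List ℤ → ℤ
sumℤ = foldr _+ℤ_ (+ 0)

-- For m ≥ 1 the sum runs over finitely supported sequences (N_0, N_1, …)
-- with m = (α+1) Σ 2^i N_i. Any such sequence has N_i ≤ m and N_i = 0 for
-- i > m (since 2^i > m), so it is enumerated exactly once by the vectors
-- (N_0, …, N_m) with entries ≤ m; the omitted factors are p̄(0) = 1.
Gamma : (pbar : ℕ → ℤ) (α m : ℕ) → ℤ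
Gamma pbar α zero    = + 1
Gamma pbar α (suc k) =
  sumℤ (map (λ v → if ⌊ suc k ≟ suc α * weight v ⌋ then prodℤ pbar v else + 0)
            (vecsUpTo (suc (suc k)) (suc k)))

sumTo : ℕ → (ℕ → ℤ) → ℤ
sumTo n f = sumℤ (map f (upTo (suc n)))

module Submission where

-- For a ranging over A, Σₙ p_α^A(n) xⁿ = ∏ₐ (1 − x^((α+1)a)) / (1 − xᵃ)
-- = P(x) D(x^(α+1)), with P = ∏ₐ 1/(1 − xᵃ) = Σ p^A(n) xⁿ and D = ∏ₐ (1 − xᵃ). Writing
-- 1 − y = (1 − y²)/(1 + y) gives D(x) = P̄(x) D(x²) with P̄ = ∏ₐ 1/(1 + xᵃ) = Σ p̄^A(n) xⁿ, hence
-- D(x) = ∏_{j≥0} P̄(x^(2^j)), and the coefficient of x^m in D(x^(α+1)) is Γ^ψ_α(m). Comparing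
-- coefficients of xⁿ gives the formula.
-- Only parts ≤ n matter, so A is replaced by the finite set A ∩ [1, n]; a product ∏ₐ f(xᵃ) over it
-- is matched with a weighted count of the explicitly enumerated partitions into such parts.

open import Defs
open import Data.Bool using (if_then_else_)
open import Data.Fin using (Fin)
import Data.Fin.Properties as Finₚ
open import Data.Fin.Permutation using (↔⇒≡)
open import Data.Integer using (ℤ; +_; -_; _+_; _*_; _-_)
import Data.Integer.Properties as ℤₚ
open import Data.Integer.Tactic.RingSolver using (solve-∀)
open import Data.List
  using (List; []; _∷_; _++_; map; concatMap; applyUpTo; upTo; downFrom; replicate; length; filter; lookup)
import Data.List.Properties as Listₚ
open import Data.List.Membership.Propositional using (_∈_; find; lose)
import Data.List.Membership.Propositional.Properties as ∈ₚ
open import Data.List.Relation.Unary.All as All using (All; []; _∷_)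
import Data.List.Relation.Unary.All.Properties as Allₚ
open import Data.List.Relation.Unary.AllPairs using (AllPairs; []; _∷_)
import Data.List.Relation.Unary.AllPairs.Properties as AllPairsₚ
open import Data.List.Relation.Unary.Any as Any using (Any; here; there)
import Data.List.Relation.Unary.Any.Properties as Anyₚ
open import Data.List.Relation.Unary.Linked as Linked using (Linked; []; [-]; _∷_)
open import Data.List.Relation.Unary.Linked.Properties using (Linked⇒AllPairs)
open import Data.List.Relation.Unary.Unique.Propositional using (Unique)
import Data.List.Relation.Unary.Unique.Propositional.Properties as Uniqueₚ
open import Data.Nat as ℕ using (ℕ; zero; suc; _≤_; _<_; _≥_; _>_; _∸_; s≤s; z≤n; _≤?_; _≟_; _%_)
import Data.Nat.Properties as ℕₚ
open import Data.Nat.Divisibility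
  using (_∣_; _∤_; _∣?_; divides; ∣-refl; ∣-trans; ∣⇒≤; n∣m*n; ∣m+n∣m⇒∣n; *-cancelʳ-∣)
open import Data.Nat.Induction using (<-rec)
open import Data.Nat.ListAction using (sum)
import Data.Nat.ListAction.Properties as ListActionₚ
open import Data.Product using (Σ; _,_; ∃₂; _×_; proj₁; proj₂)
open import Data.Sum using (_⊎_; inj₁; inj₂)
open import Data.Vec using (Vec; _∷_)
open import Function.Base using (case_of_; flip)
open import Function.Bundles using (_↔_; Inverse; mk↔ₛ′)
open import Function.Definitions using (Injective)
open import Function.Properties.Inverse using (↔-trans; ↔-sym)
open import Relation.Binary.PropositionalEquality
open import Relation.Nullary using (Dec; yes; no; ¬_; contradiction)
open import Relation.Nullary.Decidable using (⌊_⌋)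

if-yes : ∀ {P : Set} (p? : Dec P) → P → ∀ {A : Set} {x y : A} → (if ⌊ p? ⌋ then x else y) ≡ x
if-yes (yes _) _ = refl
if-yes (no ¬p) p = contradiction p ¬p

if-no : ∀ {P : Set} (p? : Dec P) → ¬ P → ∀ {A : Set} {x y : A} → (if ⌊ p? ⌋ then x else y) ≡ y
if-no (yes p) ¬p = contradiction p ¬p
if-no (no _)  _  = refl

if-equiv : ∀ {P Q : Set} (p? : Dec P) (q? : Dec Q) → (P → Q) → (Q → P) →
           ∀ {A : Set} {x y : A} → (if ⌊ p? ⌋ then x else y) ≡ (if ⌊ q? ⌋ then x else y)
if-equiv (yes _) (yes _) _   _   = refl
if-equiv (yes p) (no ¬q) p→q _   = contradiction (p→q p) ¬q
if-equiv (no ¬p) (yes q) _   q→p = contradiction (q→p q) ¬p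
if-equiv (no _)  (no _)  _   _   = refl

data LessOrOffset (k : ℕ) : ℕ → Set where
  less   : ∀ {i} → i < k → LessOrOffset k i
  offset : ∀ j → LessOrOffset k (k ℕ.+ j)

lessOrOffset : ∀ k i → LessOrOffset k i
lessOrOffset zero    i       = offset i
lessOrOffset (suc k) zero    = less (s≤s z≤n)
lessOrOffset (suc k) (suc i) with lessOrOffset k i
... | less i<k = less (s≤s i<k)
... | offset j = offset j

-- Formal power series

Series : Set
Series = ℕ → ℤ

infix 4 _≈_
_≈_ : Series → Series → Set
f ≈ g = ∀ n → f n ≡ g n

≈-sym : ∀ {f g} → f ≈ g → g ≈ f
≈-sym f≈g n = sym (f≈g n)

≈-trans : ∀ {f g h} → f ≈ g → g ≈ h → f ≈ h
≈-trans f≈g g≈h n = trans (f≈g n) (g≈h n)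

tail : Series → Series
tail f n = f (suc n)

0ₛ : Series
0ₛ _ = + 0

1ₛ : Series
1ₛ zero    = + 1
1ₛ (suc _) = + 0

infixl 6 _+ₛ_
_+ₛ_ : Series → Series → Series
(f +ₛ g) n = f n + g n

infixl 7 _·_ _⋆_
_·_ : ℤ → Series → Series
(c · f) n = c * f n

_⋆_ : Series → Series → Series
(f ⋆ g) zero    = f 0 * g 0
(f ⋆ g) (suc n) = f 0 * g (suc n) + (tail f ⋆ g) n

⋆-cong : ∀ {f f′ g g′} → f ≈ f′ → g ≈ g′ → f ⋆ g ≈ f′ ⋆ g′
⋆-cong f≈f′ g≈g′ zero    = cong₂ _*_ (f≈f′ 0) (g≈g′ 0)
⋆-cong f≈f′ g≈g′ (suc n) =
  cong₂ _+_ (cong₂ _*_ (f≈f′ 0) (g≈g′ (suc n))) (⋆-cong (λ k → f≈f′ (suc k)) g≈g′ n)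

⋆-congˡ : ∀ {f f′} g → f ≈ f′ → f ⋆ g ≈ f′ ⋆ g
⋆-congˡ g f≈f′ = ⋆-cong f≈f′ (λ _ → refl)

⋆-congʳ : ∀ f {g g′} → g ≈ g′ → f ⋆ g ≈ f ⋆ g′
⋆-congʳ f g≈g′ = ⋆-cong (λ _ → refl) g≈g′

⋆-distribʳ : ∀ f g h → (f +ₛ g) ⋆ h ≈ f ⋆ h +ₛ g ⋆ h
⋆-distribʳ f g h zero    = ℤₚ.*-distribʳ-+ (h 0) (f 0) (g 0)
⋆-distribʳ f g h (suc n) = begin
  (f 0 + g 0) * h (suc n) + ((tail f +ₛ tail g) ⋆ h) n
    ≡⟨ cong (_+_ ((f 0 + g 0) * h (suc n))) (⋆-distribʳ (tail f) (tail g) h n) ⟩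
  (f 0 + g 0) * h (suc n) + ((tail f ⋆ h) n + (tail g ⋆ h) n)
    ≡⟨ regroup (f 0) (g 0) (h (suc n)) _ _ ⟩
  (f ⋆ h) (suc n) + (g ⋆ h) (suc n) ∎
  where
  open ≡-Reasoning
  regroup : ∀ a b c d e → (a + b) * c + (d + e) ≡ (a * c + d) + (b * c + e)
  regroup = solve-∀

·-⋆ : ∀ c f g → (c · f) ⋆ g ≈ c · (f ⋆ g)
·-⋆ c f g zero    = ℤₚ.*-assoc c (f 0) (g 0)
·-⋆ c f g (suc n) = begin
  c * f 0 * g (suc n) + ((c · tail f) ⋆ g) n ≡⟨ cong (_+_ (c * f 0 * g (suc n))) (·-⋆ c (tail f) g n) ⟩
  c * f 0 * g (suc n) + c * (tail f ⋆ g) n   ≡⟨ factor c (f 0) (g (suc n)) _ ⟩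
  c * (f ⋆ g) (suc n)                        ∎
  where
  open ≡-Reasoning
  factor : ∀ c a b d → c * a * b + c * d ≡ c * (a * b + d)
  factor = solve-∀

⋆-comm : ∀ f g → f ⋆ g ≈ g ⋆ f
⋆-comm f g zero          = ℤₚ.*-comm (f 0) (g 0)
⋆-comm f g (suc zero)    = swap (f 0) (g 1) (f 1) (g 0)
  where
  swap : ∀ a b c d → a * b + c * d ≡ d * c + b * a
  swap = solve-∀
⋆-comm f g (suc (suc n)) = begin
  f 0 * g (2 ℕ.+ n) + (tail f ⋆ g) (suc n)
    ≡⟨ cong (_+_ (f 0 * g (2 ℕ.+ n))) (⋆-comm (tail f) g (suc n)) ⟩
  f 0 * g (2 ℕ.+ n) + (g 0 * f (2 ℕ.+ n) + (tail g ⋆ tail f) n)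
    ≡⟨ cong (λ x → f 0 * g (2 ℕ.+ n) + (g 0 * f (2 ℕ.+ n) + x)) (⋆-comm (tail g) (tail f) n) ⟩
  f 0 * g (2 ℕ.+ n) + (g 0 * f (2 ℕ.+ n) + (tail f ⋆ tail g) n)
    ≡⟨ exchange (f 0 * g (2 ℕ.+ n)) (g 0 * f (2 ℕ.+ n)) _ ⟩
  g 0 * f (2 ℕ.+ n) + (f 0 * g (2 ℕ.+ n) + (tail f ⋆ tail g) n)
    ≡⟨ cong (_+_ (g 0 * f (2 ℕ.+ n))) (⋆-comm f (tail g) (suc n)) ⟩
  g 0 * f (2 ℕ.+ n) + (tail g ⋆ f) (suc n) ∎
  where
  open ≡-Reasoning
  exchange : ∀ a b c → a + (b + c) ≡ b + (a + c)
  exchange = solve-∀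

⋆-assoc : ∀ f g h → (f ⋆ g) ⋆ h ≈ f ⋆ (g ⋆ h)
⋆-assoc f g h zero    = ℤₚ.*-assoc (f 0) (g 0) (h 0)
⋆-assoc f g h (suc n) = begin
  f 0 * g 0 * h (suc n) + ((f 0 · tail g +ₛ tail f ⋆ g) ⋆ h) n
    ≡⟨ cong (_+_ (f 0 * g 0 * h (suc n))) (⋆-distribʳ (f 0 · tail g) (tail f ⋆ g) h n) ⟩
  f 0 * g 0 * h (suc n) + (((f 0 · tail g) ⋆ h) n + ((tail f ⋆ g) ⋆ h) n)
    ≡⟨ cong (_+_ (f 0 * g 0 * h (suc n)))
            (cong₂ _+_ (·-⋆ (f 0) (tail g) h n) (⋆-assoc (tail f) g h n)) ⟩
  f 0 * g 0 * h (suc n) + (f 0 * (tail g ⋆ h) n + (tail f ⋆ (g ⋆ h)) n)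
    ≡⟨ factor (f 0) (g 0) (h (suc n)) _ _ ⟩
  f 0 * (g ⋆ h) (suc n) + (tail f ⋆ (g ⋆ h)) n ∎
  where
  open ≡-Reasoning
  factor : ∀ a b c d e → a * b * c + (a * d + e) ≡ a * (b * c + d) + e
  factor = solve-∀

⋆-interchange : ∀ f g h k → (f ⋆ g) ⋆ (h ⋆ k) ≈ (f ⋆ h) ⋆ (g ⋆ k)
⋆-interchange f g h k =
  ≈-trans (⋆-assoc f g (h ⋆ k)) (≈-trans (⋆-congʳ f middle) (≈-sym (⋆-assoc f h (g ⋆ k))))
  where
  middle : g ⋆ (h ⋆ k) ≈ h ⋆ (g ⋆ k)
  middle = ≈-trans (≈-sym (⋆-assoc g h k)) (≈-trans (⋆-congˡ k (⋆-comm g h)) (⋆-assoc h g k))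

⋆-zeroˡ : ∀ f → 0ₛ ⋆ f ≈ 0ₛ
⋆-zeroˡ f zero    = refl
⋆-zeroˡ f (suc n) = trans (ℤₚ.+-identityˡ _) (⋆-zeroˡ f n)

⋆-identityˡ : ∀ f → 1ₛ ⋆ f ≈ f
⋆-identityˡ f zero    = ℤₚ.*-identityˡ (f 0)
⋆-identityˡ f (suc n) =
  trans (cong₂ _+_ (ℤₚ.*-identityˡ (f (suc n))) (⋆-zeroˡ f n)) (ℤₚ.+-identityʳ (f (suc n)))

shift : ℕ → Series → Series
shift zero    f         = f
shift (suc k) f zero    = + 0
shift (suc k) f (suc m) = shift k f m

shift-offset : ∀ k f j → shift k f (k ℕ.+ j) ≡ f j
shift-offset zero    f j = refl
shift-offset (suc k) f j = shift-offset k f j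

shift-less : ∀ k f {m} → m < k → shift k f m ≡ + 0
shift-less (suc k) f {zero}  _         = refl
shift-less (suc k) f {suc m} (s≤s m<k) = shift-less k f m<k

shift-congAt : ∀ k {f g} m → (∀ j → j ℕ.+ k ≡ m → f j ≡ g j) → shift k f m ≡ shift k g m
shift-congAt zero    m       eq = eq m (ℕₚ.+-identityʳ m)
shift-congAt (suc k) zero    eq = refl
shift-congAt (suc k) (suc m) eq = shift-congAt k m (λ j j+k≡m → eq j (trans (ℕₚ.+-suc j k) (cong suc j+k≡m)))

shift-cong : ∀ k {f g} → f ≈ g → shift k f ≈ shift k g
shift-cong k f≈g m = shift-congAt k m (λ j _ → f≈g j)

shift-linear : ∀ k c f g → shift k (c · f +ₛ g) ≈ c · shift k f +ₛ shift k g
shift-linear zero    c f g m       = refl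
shift-linear (suc k) c f g zero    = sym (cong (_+ + 0) (ℤₚ.*-zeroʳ c))
shift-linear (suc k) c f g (suc m) = shift-linear k c f g m

shift-⋆ : ∀ k f g → shift k f ⋆ g ≈ shift k (f ⋆ g)
shift-⋆ zero    f g m       = refl
shift-⋆ (suc k) f g zero    = refl
shift-⋆ (suc k) f g (suc m) = trans (ℤₚ.+-identityˡ _) (shift-⋆ k f g m)

-- Substitution x ↦ x^(b+1); indexing by b rather than b+1 avoids NonZero side conditions.

dilate : ℕ → Series → Series
dilate b f m with suc b ∣? m
... | yes (divides q _) = f q
... | no _              = + 0

dilate-multiple : ∀ b f {m} q → m ≡ q ℕ.* suc b → dilate b f m ≡ f q
dilate-multiple b f q refl with suc b ∣? q ℕ.* suc b
... | yes (divides q′ eq) = cong f (ℕₚ.*-cancelʳ-≡ q′ q (suc b) (sym eq))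
... | no b+1∤m            = contradiction (n∣m*n q) b+1∤m

dilate-∤ : ∀ b f {m} → suc b ∤ m → dilate b f m ≡ + 0
dilate-∤ b f {m} b+1∤m with suc b ∣? m
... | yes b+1∣m = contradiction b+1∣m b+1∤m
... | no _      = refl

dilate-zero : ∀ b f → dilate b f 0 ≡ f 0
dilate-zero b f = dilate-multiple b f 0 refl

dilate-cong : ∀ b {f g} → f ≈ g → dilate b f ≈ dilate b g
dilate-cong b {f} {g} f≈g m with suc b ∣? m
... | yes (divides q _) = f≈g q
... | no _              = refl

dilate-linear : ∀ b c f g → dilate b (c · f +ₛ g) ≈ c · dilate b f +ₛ dilate b g
dilate-linear b c f g m with suc b ∣? m
... | yes _ = refl
... | no _  = sym (cong (_+ + 0) (ℤₚ.*-zeroʳ c))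

dilate-1ₛ : ∀ b → dilate b 1ₛ ≈ 1ₛ
dilate-1ₛ b zero = refl
dilate-1ₛ b (suc m) with suc b ∣? suc m
... | yes (divides zero    ())
... | yes (divides (suc q) _)  = refl
... | no _                     = refl

dilate-step : ∀ b f j → dilate b f (suc b ℕ.+ j) ≡ dilate b (tail f) j
dilate-step b f j = case suc b ∣? j of λ where
  (yes (divides q j≡qb)) →
    trans (dilate-multiple b f (suc q) (cong (suc b ℕ.+_) j≡qb)) (sym (dilate-multiple b (tail f) q j≡qb))
  (no b+1∤j) →
    trans (dilate-∤ b f (λ b+1∣b+1+j → b+1∤j (∣m+n∣m⇒∣n b+1∣b+1+j ∣-refl)))
          (sym (dilate-∤ b (tail f) b+1∤j))

tail-dilate : ∀ b f → tail (dilate b f) ≈ shift b (dilate b (tail f))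
tail-dilate b f i with lessOrOffset b i
... | less i<b = trans (dilate-∤ b f (λ b+1∣1+i → ℕₚ.<⇒≱ (s≤s i<b) (∣⇒≤ b+1∣1+i)))
                       (sym (shift-less b _ i<b))
... | offset j = trans (dilate-step b f j) (sym (shift-offset b _ j))

dilate-shift₁ : ∀ b f → dilate b (shift 1 f) ≈ shift (suc b) (dilate b f)
dilate-shift₁ b f zero    = dilate-zero b (shift 1 f)
dilate-shift₁ b f (suc i) = tail-dilate b (shift 1 f) i

dilate-⋆ : ∀ b f g → dilate b (f ⋆ g) ≈ dilate b f ⋆ dilate b g
dilate-⋆ b f g m = <-rec Claim step m f g
  where
  Claim : ℕ → Set
  Claim m = ∀ f g → dilate b (f ⋆ g) m ≡ (dilate b f ⋆ dilate b g) m

  step : ∀ m → (∀ {j} → j < m → Claim j) → Claim m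
  step zero    _  f g = trans (dilate-zero b (f ⋆ g)) (sym (cong₂ _*_ (dilate-zero b f) (dilate-zero b g)))
  step (suc m) ih f g = begin
    dilate b (f ⋆ g) (suc m)
      ≡⟨ tail-dilate b (f ⋆ g) m ⟩
    shift b (dilate b (f 0 · tail g +ₛ tail f ⋆ g)) m
      ≡⟨ shift-congAt b m (λ j j+b≡m →
           trans (dilate-linear b (f 0) (tail g) (tail f ⋆ g) j)
                 (cong (_+_ (f 0 * dilate b (tail g) j))
                       (ih (s≤s (ℕₚ.≤-trans (ℕₚ.m≤m+n j b) (ℕₚ.≤-reflexive j+b≡m)))
                           (tail f) g))) ⟩
    shift b (f 0 · dilate b (tail g) +ₛ dilate b (tail f) ⋆ dilate b g) m
      ≡⟨ shift-linear b (f 0) _ _ m ⟩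
    f 0 * shift b (dilate b (tail g)) m + shift b (dilate b (tail f) ⋆ dilate b g) m
      ≡⟨ cong₂ _+_ (cong₂ _*_ (sym (dilate-zero b f)) (sym (tail-dilate b g m)))
                   (sym (shift-⋆ b (dilate b (tail f)) (dilate b g) m)) ⟩
    dilate b f 0 * dilate b g (suc m) + (shift b (dilate b (tail f)) ⋆ dilate b g) m
      ≡⟨ cong (_+_ (dilate b f 0 * dilate b g (suc m)))
              (⋆-congˡ (dilate b g) (≈-sym (tail-dilate b f)) m) ⟩
    (dilate b f ⋆ dilate b g) (suc m) ∎
    where open ≡-Reasoning

-- suc (b + r * suc b) is suc r * suc b by definition: the composite dilates by (r+1)(b+1).
dilate-dilate : ∀ b r f → dilate b (dilate r f) ≈ dilate (b ℕ.+ r ℕ.* suc b) f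
dilate-dilate b r f m with suc b ∣? m
... | no b+1∤m = sym (dilate-∤ _ f (λ rb∣m → b+1∤m (∣-trans (n∣m*n (suc r)) rb∣m)))
... | yes (divides q m≡qb) with suc r ∣? q
...   | yes (divides t q≡tr) = sym (dilate-multiple _ f t
          (trans m≡qb (trans (cong (ℕ._* suc b) q≡tr) (ℕₚ.*-assoc t (suc r) (suc b)))))
...   | no r+1∤q = sym (dilate-∤ _ f (λ rb∣m → r+1∤q (*-cancelʳ-∣ (suc b) (subst (_ ∣_) m≡qb rb∣m))))

dilate-comm : ∀ b r f → dilate b (dilate r f) ≈ dilate r (dilate b f)
dilate-comm b r f m = begin
  dilate b (dilate r f) m
    ≡⟨ dilate-dilate b r f m ⟩
  dilate (b ℕ.+ r ℕ.* suc b) f m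
    ≡⟨ cong (λ k → dilate k f m) (ℕₚ.suc-injective (ℕₚ.*-comm (suc r) (suc b))) ⟩
  dilate (r ℕ.+ b ℕ.* suc r) f m
    ≡⟨ dilate-dilate r b f m ⟨
  dilate r (dilate b f) m ∎
  where open ≡-Reasoning

prodDilate : List ℕ → Series → Series
prodDilate []      f = 1ₛ
prodDilate (b ∷ S) f = dilate b f ⋆ prodDilate S f

prodDilate-cong : ∀ S {f g} → f ≈ g → prodDilate S f ≈ prodDilate S g
prodDilate-cong []      f≈g n = refl
prodDilate-cong (b ∷ S) f≈g   = ⋆-cong (dilate-cong b f≈g) (prodDilate-cong S f≈g)

prodDilate-⋆ : ∀ S f g → prodDilate S (f ⋆ g) ≈ prodDilate S f ⋆ prodDilate S g
prodDilate-⋆ []      f g n = sym (⋆-identityˡ 1ₛ n)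
prodDilate-⋆ (b ∷ S) f g   =
  ≈-trans (⋆-cong (dilate-⋆ b f g) (prodDilate-⋆ S f g))
          (⋆-interchange (dilate b f) (dilate b g) (prodDilate S f) (prodDilate S g))

prodDilate-dilate : ∀ S r f → prodDilate S (dilate r f) ≈ dilate r (prodDilate S f)
prodDilate-dilate []      r f n = sym (dilate-1ₛ r n)
prodDilate-dilate (b ∷ S) r f   =
  ≈-trans (⋆-cong (dilate-comm b r f) (prodDilate-dilate S r f))
          (≈-sym (dilate-⋆ r (dilate b f) (prodDilate S f)))

prodDilate-zero : ∀ S f → f 0 ≡ + 1 → prodDilate S f 0 ≡ + 1
prodDilate-zero []      f f₀≡1 = refl
prodDilate-zero (b ∷ S) f f₀≡1 = cong₂ _*_ (trans (dilate-zero b f) f₀≡1) (prodDilate-zero S f f₀≡1)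

geometric : Series
geometric _ = + 1

alternating : Series
alternating zero    = + 1
alternating (suc n) = - alternating n

truncGeometric : ℕ → Series
truncGeometric α m = if ⌊ m ≤? α ⌋ then + 1 else + 0

oneMinusXPow : ℕ → Series
oneMinusXPow k = - + 1 · shift k 1ₛ +ₛ 1ₛ

⋆-oneMinusXPow : ∀ f k → f ⋆ oneMinusXPow k ≈ - + 1 · shift k f +ₛ f
⋆-oneMinusXPow f k m = begin
  (f ⋆ (- + 1 · shift k 1ₛ +ₛ 1ₛ)) m
    ≡⟨ ⋆-comm f _ m ⟩
  ((- + 1 · shift k 1ₛ +ₛ 1ₛ) ⋆ f) m
    ≡⟨ ⋆-distribʳ (- + 1 · shift k 1ₛ) 1ₛ f m ⟩
  ((- + 1 · shift k 1ₛ) ⋆ f) m + (1ₛ ⋆ f) m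
    ≡⟨ cong₂ _+_ (trans (·-⋆ (- + 1) (shift k 1ₛ) f m) (cong (- + 1 *_) (shift-⋆ k 1ₛ f m)))
                 (⋆-identityˡ f m) ⟩
  - + 1 * shift k (1ₛ ⋆ f) m + f m
    ≡⟨ cong (λ x → - + 1 * x + f m) (shift-cong k (⋆-identityˡ f) m) ⟩
  - + 1 * shift k f m + f m ∎
  where open ≡-Reasoning

dilate-oneMinusX : ∀ b → dilate b (oneMinusXPow 1) ≈ oneMinusXPow (suc b)
dilate-oneMinusX b m = begin
  dilate b (- + 1 · shift 1 1ₛ +ₛ 1ₛ) m
    ≡⟨ dilate-linear b (- + 1) (shift 1 1ₛ) 1ₛ m ⟩
  - + 1 * dilate b (shift 1 1ₛ) m + dilate b 1ₛ m
    ≡⟨ cong₂ (λ x y → - + 1 * x + y)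
             (trans (dilate-shift₁ b 1ₛ m) (shift-cong (suc b) (dilate-1ₛ b) m)) (dilate-1ₛ b m) ⟩
  - + 1 * shift (suc b) 1ₛ m + 1ₛ m ∎
  where open ≡-Reasoning

truncGeometric≈ : ∀ α → truncGeometric α ≈ geometric ⋆ dilate α (oneMinusXPow 1)
truncGeometric≈ α m = begin
  truncGeometric α m                                   ≡⟨ partialSum m ⟩
  - + 1 * shift (suc α) geometric m + geometric m       ≡⟨ ⋆-oneMinusXPow geometric (suc α) m ⟨
  (geometric ⋆ oneMinusXPow (suc α)) m                 ≡⟨ ⋆-congʳ geometric (dilate-oneMinusX α) m ⟨
  (geometric ⋆ dilate α (oneMinusXPow 1)) m            ∎
  where
  open ≡-Reasoning
  partialSum : ∀ m → truncGeometric α m ≡ - + 1 * shift (suc α) geometric m + + 1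
  partialSum m with lessOrOffset (suc α) m
  ... | less (s≤s m≤α) =
    trans (if-yes (m ≤? α) m≤α)
          (sym (cong (λ x → - + 1 * x + + 1) (shift-less (suc α) geometric (s≤s m≤α))))
  ... | offset j =
    trans (if-no (suc α ℕ.+ j ≤? α) (ℕₚ.<⇒≱ (s≤s (ℕₚ.m≤m+n α j))))
          (sym (cong (λ x → - + 1 * x + + 1) (shift-offset (suc α) geometric j)))

oneMinusX≈ : oneMinusXPow 1 ≈ alternating ⋆ dilate 1 (oneMinusXPow 1)
oneMinusX≈ m = begin
  oneMinusXPow 1 m                                   ≡⟨ telescope m ⟩
  - + 1 * shift 2 alternating m + alternating m       ≡⟨ ⋆-oneMinusXPow alternating 2 m ⟨
  (alternating ⋆ oneMinusXPow 2) m                   ≡⟨ ⋆-congʳ alternating (dilate-oneMinusX 1) m ⟨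
  (alternating ⋆ dilate 1 (oneMinusXPow 1)) m        ∎
  where
  open ≡-Reasoning
  telescope : ∀ m → oneMinusXPow 1 m ≡ - + 1 * shift 2 alternating m + alternating m
  telescope zero          = refl
  telescope (suc zero)    = refl
  telescope (suc (suc k)) = cancel (alternating k)
    where
    cancel : ∀ a → + 0 ≡ - + 1 * a + - - a
    cancel = solve-∀

prodDilate-truncGeometric : ∀ S α → prodDilate S (truncGeometric α) ≈
                            dilate α (prodDilate S (oneMinusXPow 1)) ⋆ prodDilate S geometric
prodDilate-truncGeometric S α =
  ≈-trans (prodDilate-cong S (truncGeometric≈ α))
  (≈-trans (prodDilate-⋆ S geometric (dilate α (oneMinusXPow 1)))
  (≈-trans (⋆-congʳ (prodDilate S geometric) (prodDilate-dilate S α (oneMinusXPow 1)))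
           (⋆-comm _ _)))

prodDilate-oneMinusX : ∀ S → prodDilate S (oneMinusXPow 1) ≈
                       prodDilate S alternating ⋆ dilate 1 (prodDilate S (oneMinusXPow 1))
prodDilate-oneMinusX S =
  ≈-trans (prodDilate-cong S oneMinusX≈)
  (≈-trans (prodDilate-⋆ S alternating (dilate 1 (oneMinusXPow 1)))
           (⋆-congʳ (prodDilate S alternating) (prodDilate-dilate S 1 (oneMinusXPow 1))))

sumBelow : ℕ → (ℕ → ℤ) → ℤ
sumBelow zero    F = + 0
sumBelow (suc n) F = F 0 + sumBelow n (λ i → F (suc i))

sumℤ-applyUpTo : ∀ {A : Set} (F : A → ℤ) g n → sumℤ (map F (applyUpTo g n)) ≡ sumBelow n (λ i → F (g i))
sumℤ-applyUpTo F g zero    = refl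
sumℤ-applyUpTo F g (suc n) = cong (_+_ (F (g 0))) (sumℤ-applyUpTo F (λ i → g (suc i)) n)

sumℤ-upTo : ∀ (F : ℕ → ℤ) n → sumℤ (map F (upTo n)) ≡ sumBelow n F
sumℤ-upTo F = sumℤ-applyUpTo F (λ i → i)

sumBelow-cong : ∀ n {F G} → (∀ i → i < n → F i ≡ G i) → sumBelow n F ≡ sumBelow n G
sumBelow-cong zero    F≡G = refl
sumBelow-cong (suc n) F≡G =
  cong₂ _+_ (F≡G 0 (s≤s z≤n)) (sumBelow-cong n (λ i i<n → F≡G (suc i) (s≤s i<n)))

sumBelow-zero : ∀ n {F} → (∀ i → F i ≡ + 0) → sumBelow n F ≡ + 0
sumBelow-zero zero    F≡0 = refl
sumBelow-zero (suc n) F≡0 = cong₂ _+_ (F≡0 0) (sumBelow-zero n (λ i → F≡0 (suc i)))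

sumBelow-truncate : ∀ {m n} F → m ≤ n → (∀ i → m ≤ i → F i ≡ + 0) → sumBelow n F ≡ sumBelow m F
sumBelow-truncate {n = n} F z≤n       F≡0 = sumBelow-zero n (λ i → F≡0 i z≤n)
sumBelow-truncate         F (s≤s m≤n) F≡0 =
  cong (_+_ (F 0)) (sumBelow-truncate (λ i → F (suc i)) m≤n (λ i m≤i → F≡0 (suc i) (s≤s m≤i)))

⋆-as-sum : ∀ f g m → (f ⋆ g) m ≡ sumBelow (suc m) (λ i → f i * g (m ∸ i))
⋆-as-sum f g zero    = sym (ℤₚ.+-identityʳ _)
⋆-as-sum f g (suc m) = cong (_+_ (f 0 * g (suc m))) (⋆-as-sum (tail f) g m)

sumℤ-++ : ∀ xs ys → sumℤ (xs ++ ys) ≡ sumℤ xs + sumℤ ys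
sumℤ-++ []       ys = sym (ℤₚ.+-identityˡ _)
sumℤ-++ (x ∷ xs) ys = trans (cong (_+_ x) (sumℤ-++ xs ys)) (sym (ℤₚ.+-assoc x _ _))

sumℤ-concatMap : ∀ {A B : Set} (F : B → ℤ) (G : A → List B) xs →
                 sumℤ (map F (concatMap G xs)) ≡ sumℤ (map (λ x → sumℤ (map F (G x))) xs)
sumℤ-concatMap F G []       = refl
sumℤ-concatMap F G (x ∷ xs) = begin
  sumℤ (map F (G x ++ concatMap G xs))
    ≡⟨ cong sumℤ (Listₚ.map-++ F (G x) _) ⟩
  sumℤ (map F (G x) ++ map F (concatMap G xs))
    ≡⟨ sumℤ-++ (map F (G x)) _ ⟩
  sumℤ (map F (G x)) + sumℤ (map F (concatMap G xs))
    ≡⟨ cong (_+_ (sumℤ (map F (G x)))) (sumℤ-concatMap F G xs) ⟩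
  sumℤ (map F (G x)) + sumℤ (map (λ x → sumℤ (map F (G x))) xs) ∎
  where open ≡-Reasoning

sumℤ-map-cong-∈ : ∀ {A : Set} {F G : A → ℤ} xs → (∀ x → x ∈ xs → F x ≡ G x) →
                  sumℤ (map F xs) ≡ sumℤ (map G xs)
sumℤ-map-cong-∈ []       F≡G = refl
sumℤ-map-cong-∈ (x ∷ xs) F≡G =
  cong₂ _+_ (F≡G x (here refl)) (sumℤ-map-cong-∈ xs (λ y y∈xs → F≡G y (there y∈xs)))

sumℤ-map-cong : ∀ {A : Set} {F G : A → ℤ} xs → (∀ x → F x ≡ G x) →
                sumℤ (map F xs) ≡ sumℤ (map G xs)
sumℤ-map-cong xs F≡G = sumℤ-map-cong-∈ xs (λ x _ → F≡G x)

sumℤ-map-zero : ∀ {A : Set} {F : A → ℤ} xs → (∀ x → F x ≡ + 0) → sumℤ (map F xs) ≡ + 0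
sumℤ-map-zero []       F≡0 = refl
sumℤ-map-zero (x ∷ xs) F≡0 = cong₂ _+_ (F≡0 x) (sumℤ-map-zero xs F≡0)

sumℤ-map-*ˡ : ∀ {A : Set} c (F : A → ℤ) xs → sumℤ (map (λ x → c * F x) xs) ≡ c * sumℤ (map F xs)
sumℤ-map-*ˡ c F []       = sym (ℤₚ.*-zeroʳ c)
sumℤ-map-*ˡ c F (x ∷ xs) =
  trans (cong (_+_ (c * F x)) (sumℤ-map-*ˡ c F xs)) (sym (ℤₚ.*-distribˡ-+ c (F x) _))

-- Γ as the coefficients of a dilated infinite product

n<2^n : ∀ n → n < 2 ℕ.^ n
n<2^n zero    = s≤s z≤n
n<2^n (suc n) = subst₂ _≤_ (ℕₚ.+-comm (suc n) 1) (cong (2 ℕ.^ n ℕ.+_) (sym (ℕₚ.+-identityʳ (2 ℕ.^ n))))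
                       (ℕₚ.+-mono-≤ (n<2^n n) (ℕₚ.m^n>0 2 n))

∸-cancelˡ : ∀ {w} N {m} → w ≡ N ℕ.+ m → w ∸ N ≡ m
∸-cancelˡ N {m} w≡N+m = trans (cong (_∸ N) w≡N+m) (ℕₚ.m+n∸m≡n N m)

-- The coefficient of x^w in ∏_{j<L} pbar(x^(2^j)), counting only exponents of pbar up to b.
weightSum : (pbar : Series) (L b w : ℕ) → ℤ
weightSum pbar L b w = sumℤ (map (λ v → if ⌊ w ≟ weight v ⌋ then prodℤ pbar v else + 0) (vecsUpTo L b))

weightSumAfter : (pbar : Series) (L b w N : ℕ) → ℤ
weightSumAfter pbar L b w N =
  sumℤ (map (λ v → if ⌊ w ≟ N ℕ.+ 2 ℕ.* weight v ⌋ then prodℤ pbar v else + 0) (vecsUpTo L b))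

module _ (pbar : Series) (L b w : ℕ) where

  weightSum-suc : weightSum pbar (suc L) b w ≡ sumBelow (suc b) (λ N → pbar N * weightSumAfter pbar L b w N)
  weightSum-suc = begin
    sumℤ (map term (concatMap (λ N → map (N ∷_) (vecsUpTo L b)) (upTo (suc b))))
      ≡⟨ sumℤ-concatMap term (λ N → map (N ∷_) (vecsUpTo L b)) (upTo (suc b)) ⟩
    sumℤ (map (λ N → sumℤ (map term (map (N ∷_) (vecsUpTo L b)))) (upTo (suc b)))
      ≡⟨ sumℤ-map-cong (upTo (suc b)) (λ N → trans (cong sumℤ (sym (Listₚ.map-∘ (vecsUpTo L b))))
           (trans (sumℤ-map-cong (vecsUpTo L b) (factorHead N)) (sumℤ-map-*ˡ (pbar N) _ (vecsUpTo L b)))) ⟩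
    sumℤ (map (λ N → pbar N * weightSumAfter pbar L b w N) (upTo (suc b)))
      ≡⟨ sumℤ-upTo (λ N → pbar N * weightSumAfter pbar L b w N) (suc b) ⟩
    sumBelow (suc b) (λ N → pbar N * weightSumAfter pbar L b w N) ∎
    where
    open ≡-Reasoning
    term : Vec ℕ (suc L) → ℤ
    term v = if ⌊ w ≟ weight v ⌋ then prodℤ pbar v else + 0
    factorHead : ∀ N v →
                 term (N ∷ v) ≡ pbar N * (if ⌊ w ≟ N ℕ.+ 2 ℕ.* weight v ⌋ then prodℤ pbar v else + 0)
    factorHead N v with w ≟ N ℕ.+ 2 ℕ.* weight v
    ... | yes _ = refl
    ... | no _  = sym (ℤₚ.*-zeroʳ (pbar N))

  weightSumAfter-> : ∀ N → w < N → weightSumAfter pbar L b w N ≡ + 0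
  weightSumAfter-> N w<N = sumℤ-map-zero (vecsUpTo L b) (λ v → if-no (w ≟ N ℕ.+ 2 ℕ.* weight v)
    (λ w≡ → ℕₚ.<⇒≱ w<N (ℕₚ.≤-trans (ℕₚ.m≤m+n N _) (ℕₚ.≤-reflexive (sym w≡)))))

  weightSumAfter-even : ∀ {N x} → N ≤ w → w ∸ N ≡ x ℕ.* 2 →
                        weightSumAfter pbar L b w N ≡ weightSum pbar L b x
  weightSumAfter-even {N} {x} N≤w w∸N≡x*2 = sumℤ-map-cong (vecsUpTo L b) (λ v →
    if-equiv (w ≟ N ℕ.+ 2 ℕ.* weight v) (x ≟ weight v)
      (λ w≡ → ℕₚ.*-cancelʳ-≡ x (weight v) 2
                (trans (sym w∸N≡x*2) (trans (∸-cancelˡ N w≡) (ℕₚ.*-comm 2 (weight v)))))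
      (λ x≡ → trans (sym (ℕₚ.m+[n∸m]≡n N≤w))
                (cong (N ℕ.+_) (trans w∸N≡x*2 (trans (cong (ℕ._* 2) x≡) (ℕₚ.*-comm (weight v) 2))))))

  weightSumAfter-odd : ∀ {N} → 2 ∤ w ∸ N → weightSumAfter pbar L b w N ≡ + 0
  weightSumAfter-odd {N} 2∤w∸N = sumℤ-map-zero (vecsUpTo L b) (λ v → if-no (w ≟ N ℕ.+ 2 ℕ.* weight v)
    (λ w≡ → 2∤w∸N (divides (weight v) (trans (∸-cancelˡ N w≡) (ℕₚ.*-comm 2 (weight v))))))

module _ (pbar : Series) (α k : ℕ) where

  Gamma-multiple : ∀ {w} → suc k ≡ w ℕ.* suc α → Gamma pbar α (suc k) ≡ weightSum pbar (2 ℕ.+ k) (suc k) w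
  Gamma-multiple {w} 1+k≡w*[1+α] = sumℤ-map-cong (vecsUpTo (2 ℕ.+ k) (suc k)) (λ v →
    if-equiv (suc k ≟ suc α ℕ.* weight v) (w ≟ weight v)
      (λ 1+k≡ → ℕₚ.*-cancelʳ-≡ w (weight v) (suc α)
                  (trans (sym 1+k≡w*[1+α]) (trans 1+k≡ (ℕₚ.*-comm (suc α) (weight v)))))
      (λ w≡ → trans 1+k≡w*[1+α] (trans (cong (ℕ._* suc α) w≡) (ℕₚ.*-comm (weight v) (suc α)))))

  Gamma-∤ : suc α ∤ suc k → Gamma pbar α (suc k) ≡ + 0
  Gamma-∤ α+1∤1+k = sumℤ-map-zero (vecsUpTo (2 ℕ.+ k) (suc k)) (λ v → if-no (suc k ≟ suc α ℕ.* weight v)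
    (λ 1+k≡ → α+1∤1+k (divides (weight v) (trans 1+k≡ (ℕₚ.*-comm (suc α) (weight v))))))

-- Iterating D(x) = Q(x) D(x²) with D(0) = 1 gives D(x) = ∏_j Q(x^(2^j)); pbar only needs to agree
-- with Q up to B.
module _ (pbar Q D : Series) (B : ℕ) (pbar≡Q : ∀ N → N ≤ B → pbar N ≡ Q N)
         (D≈Q⋆D[x²] : D ≈ Q ⋆ dilate 1 D) (D₀≡1 : D 0 ≡ + 1) where

  weightSum≡ : ∀ L b w → b ≤ B → w ≤ b → w < 2 ℕ.^ L → weightSum pbar L b w ≡ D w
  weightSum≡ zero    b zero    _   _   _           = sym D₀≡1
  weightSum≡ zero    b (suc w) _   _   (s≤s ())
  weightSum≡ (suc L) b w       b≤B w≤b w<2^[1+L] = begin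
    weightSum pbar (suc L) b w
      ≡⟨ weightSum-suc pbar L b w ⟩
    sumBelow (suc b) (λ N → pbar N * weightSumAfter pbar L b w N)
      ≡⟨ sumBelow-truncate _ (s≤s w≤b) (λ N w<N → trans (cong (pbar N *_) (weightSumAfter-> pbar L b w N w<N))
                                                         (ℤₚ.*-zeroʳ (pbar N))) ⟩
    sumBelow (suc w) (λ N → pbar N * weightSumAfter pbar L b w N)
      ≡⟨ sumBelow-cong (suc w) (λ N N<1+w → let N≤w = ℕₚ.≤-pred N<1+w in
           cong₂ _*_ (pbar≡Q N (ℕₚ.≤-trans N≤w (ℕₚ.≤-trans w≤b b≤B)))
                     (after≡ N≤w (2 ∣? w ∸ N))) ⟩
    sumBelow (suc w) (λ N → Q N * dilate 1 D (w ∸ N))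
      ≡⟨ ⋆-as-sum Q (dilate 1 D) w ⟨
    (Q ⋆ dilate 1 D) w
      ≡⟨ D≈Q⋆D[x²] w ⟨
    D w ∎
    where
    open ≡-Reasoning
    after≡ : ∀ {N} → N ≤ w → Dec (2 ∣ w ∸ N) → weightSumAfter pbar L b w N ≡ dilate 1 D (w ∸ N)
    after≡ {N} N≤w (yes (divides x w∸N≡x*2)) =
      trans (weightSumAfter-even pbar L b w N≤w w∸N≡x*2)
            (trans (weightSum≡ L b x b≤B x≤b x<2^L) (sym (dilate-multiple 1 D x w∸N≡x*2)))
      where
      x*2≤w : x ℕ.* 2 ≤ w
      x*2≤w = ℕₚ.≤-trans (ℕₚ.≤-reflexive (sym w∸N≡x*2)) (ℕₚ.m∸n≤m w N)
      x≤b : x ≤ b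
      x≤b = ℕₚ.≤-trans (ℕₚ.m≤m*n x 2) (ℕₚ.≤-trans x*2≤w w≤b)
      x<2^L : x < 2 ℕ.^ L
      x<2^L = ℕₚ.*-cancelʳ-< 2 x (2 ℕ.^ L)
                (ℕₚ.≤-trans (s≤s x*2≤w) (ℕₚ.≤-trans w<2^[1+L] (ℕₚ.≤-reflexive (ℕₚ.*-comm 2 (2 ℕ.^ L)))))
    after≡ {N} N≤w (no 2∤w∸N) =
      trans (weightSumAfter-odd pbar L b w {N} 2∤w∸N) (sym (dilate-∤ 1 D 2∤w∸N))

  Gamma≡dilate : ∀ α i → i ≤ B → Gamma pbar α i ≡ dilate α D i
  Gamma≡dilate α zero    _     = trans (sym D₀≡1) (sym (dilate-zero α D))
  Gamma≡dilate α (suc k) 1+k≤B = byDivisibility (suc α ∣? suc k)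
    where
    byDivisibility : Dec (suc α ∣ suc k) → Gamma pbar α (suc k) ≡ dilate α D (suc k)
    byDivisibility (no α+1∤1+k) = trans (Gamma-∤ pbar α k α+1∤1+k) (sym (dilate-∤ α D α+1∤1+k))
    byDivisibility (yes (divides w 1+k≡w*[1+α])) =
      trans (Gamma-multiple pbar α k 1+k≡w*[1+α])
            (trans (weightSum≡ (2 ℕ.+ k) (suc k) w 1+k≤B w≤1+k w<2^[2+k])
                   (sym (dilate-multiple α D w 1+k≡w*[1+α])))
      where
      w≤1+k : w ≤ suc k
      w≤1+k = ℕₚ.≤-trans (ℕₚ.m≤m*n w (suc α)) (ℕₚ.≤-reflexive (sym 1+k≡w*[1+α]))
      w<2^[2+k] : w < 2 ℕ.^ (2 ℕ.+ k)
      w<2^[2+k] = ℕₚ.≤-trans (s≤s w≤1+k) (ℕₚ.<⇒≤ (n<2^n (2 ℕ.+ k)))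

-- Enumerating partitions with parts from a finite set

sum-replicate : ∀ c a → sum (replicate c a) ≡ c ℕ.* a
sum-replicate zero    a = refl
sum-replicate (suc c) a = cong (a ℕ.+_) (sum-replicate c a)

linked-replicate-++ : ∀ c a {ys} → Linked _≥_ ys → All (_≤ a) ys → Linked _≥_ (replicate c a ++ ys)
linked-replicate-++ zero          a ys↓ _             = ys↓
linked-replicate-++ (suc zero)    a []  _             = [-]
linked-replicate-++ (suc zero)    a ys↓ (y≤a ∷ _)     = y≤a ∷ ys↓
linked-replicate-++ (suc (suc c)) a ys↓ ys≤a          = ℕₚ.≤-refl ∷ linked-replicate-++ (suc c) a ys↓ ys≤a

linked-++⁻ʳ : ∀ xs {ys} → Linked _≥_ (xs ++ ys) → Linked _≥_ ys
linked-++⁻ʳ []           ys↓          = ys↓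
linked-++⁻ʳ (x ∷ [])     {[]} _       = []
linked-++⁻ʳ (x ∷ [])     {_ ∷ _} (_ ∷ ys↓) = ys↓
linked-++⁻ʳ (x ∷ y ∷ xs) (_ ∷ xs↓)    = linked-++⁻ʳ (y ∷ xs) xs↓

linked-head-≥ : ∀ {y ys} → Linked _≥_ (y ∷ ys) → All (_≤ y) ys
linked-head-≥ ys↓ with Linked⇒AllPairs (flip ℕₚ.≤-trans) ys↓
... | y≥ys ∷ _ = y≥ys

splitLeading : ∀ a xs → Linked _≥_ xs → All (_≤ a) xs →
               ∃₂ λ c ys → xs ≡ replicate c a ++ ys × All (_< a) ys
splitLeading a []       _   _           = 0 , [] , refl , []
splitLeading a (x ∷ xs) xs↓ (x≤a ∷ xs≤a) with x ≟ a
... | yes refl with splitLeading a xs (Linked.tail xs↓) xs≤a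
...   | c , ys , refl , ys<a = suc c , ys , refl , ys<a
splitLeading a (x ∷ xs) xs↓ (x≤a ∷ xs≤a) | no x≢a =
  0 , x ∷ xs , refl , x<a ∷ All.map (λ y≤x → ℕₚ.≤-<-trans y≤x x<a) (linked-head-≥ xs↓)
  where x<a = ℕₚ.≤∧≢⇒< x≤a x≢a

IsPart : List ℕ → ℕ → Set
IsPart S x = Any (λ b → x ≡ suc b) S

isPart-≤ : ∀ {b S x} → All (_< b) S → IsPart S x → x ≤ b
isPart-≤ S<b x∈S with find x∈S
... | _ , b′∈S , refl = All.lookup S<b b′∈S

isPart-∷-≤ : ∀ {b S x} → All (_< b) S → IsPart (b ∷ S) x → x ≤ suc b
isPart-∷-≤ S<b (here refl) = ℕₚ.≤-refl
isPart-∷-≤ S<b (there x∈S) = ℕₚ.m≤n⇒m≤1+n (isPart-≤ S<b x∈S)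

isPart-pos : ∀ {S x} → IsPart S x → 1 ≤ x
isPart-pos x∈S with find x∈S
... | _ , _ , refl = s≤s z≤n

block : ℕ → ℕ → List (List ℕ) → List (List ℕ)
block b i G with suc b ∣? i
... | yes (divides c _) = map (replicate c (suc b) ++_) G
... | no _              = []

∈-block⁻ : ∀ b i G {xs} → xs ∈ block b i G →
           ∃₂ λ c ys → i ≡ c ℕ.* suc b × ys ∈ G × xs ≡ replicate c (suc b) ++ ys
∈-block⁻ b i G xs∈ with suc b ∣? i
∈-block⁻ b i G xs∈ | yes (divides c i≡cb) with ∈ₚ.∈-map⁻ (replicate c (suc b) ++_) xs∈
... | ys , ys∈G , refl = c , ys , i≡cb , ys∈G , refl
∈-block⁻ b i G () | no _

∈-block⁺ : ∀ b {i} c G {ys} → i ≡ c ℕ.* suc b → ys ∈ G → replicate c (suc b) ++ ys ∈ block b i G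
∈-block⁺ b {i} c G i≡cb ys∈G with suc b ∣? i
... | yes (divides c′ i≡c′b) rewrite ℕₚ.*-cancelʳ-≡ c′ c (suc b) (trans (sym i≡c′b) i≡cb) =
  ∈ₚ.∈-map⁺ (replicate c (suc b) ++_) ys∈G
... | no b+1∤i = contradiction (divides c i≡cb) b+1∤i

-- For strictly decreasing S, the non-increasing lists of parts b+1 (b ∈ S) summing to m; the
-- index i is the total size c(b+1) of the c parts of the largest size b+1.
partitionsInto : List ℕ → ℕ → List (List ℕ)
partitionsInto []      zero    = [] ∷ []
partitionsInto []      (suc m) = []
partitionsInto (b ∷ S) m       = concatMap (λ i → block b i (partitionsInto S (m ∸ i))) (upTo (suc m))

IsPartition : List ℕ → ℕ → List ℕ → Set
IsPartition S m xs = Linked _≥_ xs × All (IsPart S) xs × sum xs ≡ m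

partitionsInto-sound : ∀ S → AllPairs _>_ S → ∀ m {xs} → xs ∈ partitionsInto S m → IsPartition S m xs
partitionsInto-sound []      _          zero    (here refl) = [] , [] , refl
partitionsInto-sound []      _          zero    (there ())
partitionsInto-sound []      _          (suc m) ()
partitionsInto-sound (b ∷ S) (S<b ∷ S↓) m       xs∈
  with find (∈ₚ.∈-concatMap⁻ (λ i → block b i (partitionsInto S (m ∸ i))) {xs = upTo (suc m)} xs∈)
... | i , i∈upTo , xs∈block with ∈-block⁻ b i _ xs∈block
...   | c , ys , i≡cb , ys∈ , refl with partitionsInto-sound S S↓ (m ∸ i) ys∈
...     | ys↓ , ysParts , ∑ys≡m∸i =
  linked-replicate-++ c (suc b) ys↓ (All.map (λ y∈S → isPart-∷-≤ S<b (there y∈S)) ysParts) ,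
  Allₚ.++⁺ (Allₚ.replicate⁺ c (here refl)) (All.map there ysParts) ,
  (begin
    sum (replicate c (suc b) ++ ys)
      ≡⟨ ListActionₚ.sum-++ (replicate c (suc b)) ys ⟩
    sum (replicate c (suc b)) ℕ.+ sum ys
      ≡⟨ cong₂ ℕ._+_ (trans (sum-replicate c (suc b)) (sym i≡cb)) ∑ys≡m∸i ⟩
    i ℕ.+ (m ∸ i)
      ≡⟨ ℕₚ.m+[n∸m]≡n (ℕₚ.≤-pred (∈ₚ.∈-upTo⁻ i∈upTo)) ⟩
    m ∎)
  where open ≡-Reasoning

partitionsInto-complete : ∀ S → AllPairs _>_ S → ∀ m {xs} → IsPartition S m xs → xs ∈ partitionsInto S m
partitionsInto-complete []      _          .0 {[]}    (_ , _ , refl) = here refl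
partitionsInto-complete []      _          m  {_ ∷ _} (_ , () ∷ _ , _)
partitionsInto-complete (b ∷ S) (S<b ∷ S↓) m  {xs}    (xs↓ , xsParts , ∑xs≡m)
  with splitLeading (suc b) xs xs↓ (All.map (isPart-∷-≤ S<b) xsParts)
... | c , ys , refl , ys<b+1 =
  ∈ₚ.∈-concatMap⁺ (λ i → block b i (partitionsInto S (m ∸ i))) {xs = upTo (suc m)}
    (lose (∈ₚ.∈-upTo⁺ (s≤s i≤m)) (∈-block⁺ b c _ refl ys∈))
  where
  i : ℕ
  i = c ℕ.* suc b
  ysParts : All (IsPart S) ys
  ysParts = All.zipWith (λ where (here refl , b+1<b+1) → contradiction b+1<b+1 (ℕₚ.<-irrefl refl)
                                 (there y∈S , _)       → y∈S)
                        (Allₚ.++⁻ʳ (replicate c (suc b)) xsParts , ys<b+1)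
  i+∑ys≡m : i ℕ.+ sum ys ≡ m
  i+∑ys≡m = trans (cong (ℕ._+ sum ys) (sym (sum-replicate c (suc b))))
                  (trans (sym (ListActionₚ.sum-++ (replicate c (suc b)) ys)) ∑xs≡m)
  i≤m : i ≤ m
  i≤m = ℕₚ.≤-trans (ℕₚ.m≤m+n i (sum ys)) (ℕₚ.≤-reflexive i+∑ys≡m)
  ys∈ : ys ∈ partitionsInto S (m ∸ i)
  ys∈ = partitionsInto-complete S S↓ (m ∸ i)
          (linked-++⁻ʳ (replicate c (suc b)) xs↓ , ysParts ,
           trans (sym (ℕₚ.m+n∸m≡n i (sum ys))) (cong (_∸ i) i+∑ys≡m))

occ-++ : ∀ a xs ys → occ a (xs ++ ys) ≡ occ a xs ℕ.+ occ a ys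
occ-++ a xs ys = trans (cong length (Listₚ.filter-++ (a ≟_) xs ys)) (Listₚ.length-++ (filter (a ≟_) xs))

occ-replicate : ∀ a c → occ a (replicate c a) ≡ c
occ-replicate a zero    = refl
occ-replicate a (suc c) = trans (cong length (Listₚ.filter-accept (a ≟_) {xs = replicate c a} refl))
                                (cong suc (occ-replicate a c))

occ-absent : ∀ a ys → All (_≢ a) ys → occ a ys ≡ 0
occ-absent a []       _           = refl
occ-absent a (y ∷ ys) (y≢a ∷ ys≢a) =
  trans (cong length (Listₚ.filter-reject (a ≟_) {xs = ys} (λ a≡y → y≢a (sym a≡y)))) (occ-absent a ys ys≢a)

occ-replicate-++ : ∀ a c ys → All (_≢ a) ys → occ a (replicate c a ++ ys) ≡ c
occ-replicate-++ a c ys ys≢a =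
  trans (occ-++ a (replicate c a) ys)
        (trans (cong₂ ℕ._+_ (occ-replicate a c) (occ-absent a ys ys≢a)) (ℕₚ.+-identityʳ c))

occ-replicate-++-≢ : ∀ a c ys {x} → x ≢ a → occ x (replicate c a ++ ys) ≡ occ x ys
occ-replicate-++-≢ a c ys {x} x≢a =
  trans (occ-++ x (replicate c a) ys)
        (cong (ℕ._+ occ x ys) (occ-absent x (replicate c a) (Allₚ.replicate⁺ c (λ a≡x → x≢a (sym a≡x)))))

concatMap-unique : ∀ {A B : Set} (G : A → List B) (tag : B → A) {xs} → Unique xs →
                   (∀ x → Unique (G x)) → (∀ x {y} → y ∈ G x → tag y ≡ x) → Unique (concatMap G xs)
concatMap-unique G tag []                 G! tag∘G = []
concatMap-unique G tag {x ∷ xs} (x∉xs ∷ xs!) G! tag∘G =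
  Uniqueₚ.++⁺ (G! x) (concatMap-unique G tag xs! G! tag∘G) disjoint
  where
  disjoint : ∀ {y} → ¬ (y ∈ G x × y ∈ concatMap G xs)
  disjoint (y∈Gx , y∈rest) with find (∈ₚ.∈-concatMap⁻ G {xs = xs} y∈rest)
  ... | x′ , x′∈xs , y∈Gx′ = All.lookup x∉xs x′∈xs (trans (sym (tag∘G x y∈Gx)) (tag∘G x′ y∈Gx′))

isPart-≢-head : ∀ {b S x} → All (_< b) S → IsPart S x → x ≢ suc b
isPart-≢-head S<b x∈S refl = ℕₚ.<-irrefl refl (s≤s (isPart-≤ S<b x∈S))

partitionsInto-unique : ∀ S → AllPairs _>_ S → ∀ m → Unique (partitionsInto S m)
partitionsInto-unique []      _          zero    = [] ∷ []
partitionsInto-unique []      _          (suc m) = []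
partitionsInto-unique (b ∷ S) (S<b ∷ S↓) m       =
  concatMap-unique _ (λ xs → occ (suc b) xs ℕ.* suc b) (Uniqueₚ.upTo⁺ (suc m)) block-unique size-of-block
  where
  block-unique : ∀ i → Unique (block b i (partitionsInto S (m ∸ i)))
  block-unique i with suc b ∣? i
  ... | yes (divides c _) = Uniqueₚ.map⁺ (Listₚ.++-cancelˡ (replicate c (suc b)) _ _)
                                         (partitionsInto-unique S S↓ (m ∸ i))
  ... | no _              = []

  size-of-block : ∀ i {xs} → xs ∈ block b i (partitionsInto S (m ∸ i)) → occ (suc b) xs ℕ.* suc b ≡ i
  size-of-block i xs∈ with ∈-block⁻ b i _ xs∈
  ... | c , ys , i≡cb , ys∈ , refl = trans (cong (ℕ._* suc b) (occ-replicate-++ (suc b) c ys ys≢b+1)) (sym i≡cb)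
    where ys≢b+1 = All.map (isPart-≢-head S<b) (proj₁ (proj₂ (partitionsInto-sound S S↓ (m ∸ i) ys∈)))

module _ (W : List ℕ → ℤ) (f : Series) (W[]≡1 : W [] ≡ + 1)
         (W-replicate-++ : ∀ a c ys → All (_≢ a) ys → W (replicate c a ++ ys) ≡ f c * W ys) where

  sumℤ-partitionsInto : ∀ S → AllPairs _>_ S → ∀ m → sumℤ (map W (partitionsInto S m)) ≡ prodDilate S f m
  sumℤ-partitionsInto []      _          zero    = trans (ℤₚ.+-identityʳ (W [])) W[]≡1
  sumℤ-partitionsInto []      _          (suc m) = refl
  sumℤ-partitionsInto (b ∷ S) (S<b ∷ S↓) m       = begin
    sumℤ (map W (concatMap (λ i → block b i (partitionsInto S (m ∸ i))) (upTo (suc m))))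
      ≡⟨ sumℤ-concatMap W (λ i → block b i (partitionsInto S (m ∸ i))) (upTo (suc m)) ⟩
    sumℤ (map (λ i → sumℤ (map W (block b i (partitionsInto S (m ∸ i))))) (upTo (suc m)))
      ≡⟨ sumℤ-map-cong (upTo (suc m)) sumℤ-block ⟩
    sumℤ (map (λ i → dilate b f i * prodDilate S f (m ∸ i)) (upTo (suc m)))
      ≡⟨ sumℤ-upTo (λ i → dilate b f i * prodDilate S f (m ∸ i)) (suc m) ⟩
    sumBelow (suc m) (λ i → dilate b f i * prodDilate S f (m ∸ i))
      ≡⟨ ⋆-as-sum (dilate b f) (prodDilate S f) m ⟨
    (dilate b f ⋆ prodDilate S f) m ∎
    where
    open ≡-Reasoning
    sumℤ-block : ∀ i → sumℤ (map W (block b i (partitionsInto S (m ∸ i)))) ≡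
                       dilate b f i * prodDilate S f (m ∸ i)
    sumℤ-block i with suc b ∣? i
    ... | no _              = refl
    ... | yes (divides c _) = begin
      sumℤ (map W (map (replicate c (suc b) ++_) G))      ≡⟨ cong sumℤ (Listₚ.map-∘ G) ⟨
      sumℤ (map (λ ys → W (replicate c (suc b) ++ ys)) G) ≡⟨ sumℤ-map-cong-∈ G W-block ⟩
      sumℤ (map (λ ys → f c * W ys) G)                    ≡⟨ sumℤ-map-*ˡ (f c) W G ⟩
      f c * sumℤ (map W G)                               ≡⟨ cong (f c *_) (sumℤ-partitionsInto S S↓ (m ∸ i)) ⟩
      f c * prodDilate S f (m ∸ i)                       ∎
      where
      G : List (List ℕ)
      G = partitionsInto S (m ∸ i)
      W-block : ∀ ys → ys ∈ G → W (replicate c (suc b) ++ ys) ≡ f c * W ys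
      W-block ys ys∈ = W-replicate-++ (suc b) c ys
        (All.map (isPart-≢-head S<b) (proj₁ (proj₂ (partitionsInto-sound S S↓ (m ∸ i) ys∈))))

index-∈-lookup : ∀ {C : Set} (L : List C) i → Any.index (∈ₚ.∈-lookup {xs = L} i) ≡ i
index-∈-lookup (c ∷ L) Fin.zero    = refl
index-∈-lookup (c ∷ L) (Fin.suc i) = cong Fin.suc (index-∈-lookup L i)

index-unique : ∀ {C : Set} {L : List C} → Unique L → ∀ {c d} (c∈L : c ∈ L) (d∈L : d ∈ L) → c ≡ d →
               Any.index c∈L ≡ Any.index d∈L
index-unique _            (here refl) (here refl) _    = refl
index-unique (c∉L ∷ _)    (here refl) (there d∈L) refl = contradiction refl (All.lookup c∉L d∈L)
index-unique (d∉L ∷ _)    (there c∈L) (here refl) refl = contradiction refl (All.lookup d∉L c∈L)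
index-unique (_   ∷ L!)   (there c∈L) (there d∈L) c≡d  = cong Fin.suc (index-unique L! c∈L d∈L c≡d)

hasCard-enumeration : ∀ {X C : Set} (code : X → C) → Injective _≡_ _≡_ code →
                      ∀ L → Unique L → (∀ x → code x ∈ L) →
                      (decode : ∀ c → c ∈ L → X) → (∀ c c∈L → code (decode c c∈L) ≡ c) →
                      HasCard X (length L)
hasCard-enumeration {X} code code-injective L L! complete decode code∘decode = mk↔ₛ′ to from to∘from from∘to
  where
  to : Fin (length L) → X
  to i = decode (lookup L i) (∈ₚ.∈-lookup i)
  from : X → Fin (length L)
  from x = Any.index (complete x)
  to∘from : ∀ x → to (from x) ≡ x
  to∘from x = code-injective (trans (code∘decode _ _) (sym (Anyₚ.lookup-index (complete x))))
  from∘to : ∀ i → from (to i) ≡ i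
  from∘to i = trans (index-unique L! (complete (to i)) (∈ₚ.∈-lookup i) (code∘decode _ _)) (index-∈-lookup L i)

hasCard-unique : ∀ {X k k′} → HasCard X k → HasCard X k′ → k ≡ k′
hasCard-unique X≅k X≅k′ = ↔⇒≡ (↔-trans X≅k (↔-sym X≅k′))

All-≤-sum : ∀ xs → All (_≤ sum xs) xs
All-≤-sum []       = []
All-≤-sum (x ∷ xs) =
  ℕₚ.m≤m+n x (sum xs) ∷ All.map (λ y≤∑xs → ℕₚ.≤-trans y≤∑xs (ℕₚ.m≤n+m (sum xs) x)) (All-≤-sum xs)

+length≡sumℤ : ∀ {C : Set} (L : List C) → + length L ≡ sumℤ (map (λ _ → + 1) L)
+length≡sumℤ []      = refl
+length≡sumℤ (x ∷ L) = cong (_+_ (+ 1)) (+length≡sumℤ L)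

+length-filter≡sumℤ : ∀ {C : Set} {Q : C → Set} (Q? : ∀ x → Dec (Q x)) L →
                      + length (filter Q? L) ≡ sumℤ (map (λ x → if ⌊ Q? x ⌋ then + 1 else + 0) L)
+length-filter≡sumℤ Q? []      = refl
+length-filter≡sumℤ Q? (x ∷ L) with Q? x
... | yes _ = cong (_+_ (+ 1)) (+length-filter≡sumℤ Q? L)
... | no _  = trans (+length-filter≡sumℤ Q? L) (sym (ℤₚ.+-identityˡ _))

alternating-+ : ∀ c k → alternating (c ℕ.+ k) ≡ alternating c * alternating k
alternating-+ zero    k = sym (ℤₚ.*-identityˡ (alternating k))
alternating-+ (suc c) k = trans (cong -_ (alternating-+ c k)) (ℤₚ.neg-distribˡ-* (alternating c) (alternating k))

alternating-parity : ∀ k → (k % 2 ≡ 0 × alternating k ≡ + 1) ⊎ (k % 2 ≡ 1 × alternating k ≡ - + 1)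
alternating-parity zero          = inj₁ (refl , refl)
alternating-parity (suc zero)    = inj₂ (refl , refl)
alternating-parity (suc (suc k)) with alternating-parity k
... | inj₁ (k%2≡0 , alt≡1)  = inj₁ (k%2≡0 , trans (ℤₚ.neg-involutive (alternating k)) alt≡1)
... | inj₂ (k%2≡1 , alt≡-1) = inj₂ (k%2≡1 , trans (ℤₚ.neg-involutive (alternating k)) alt≡-1)

even? : (xs : List ℕ) → Dec (length xs % 2 ≡ 0)
even? xs = length xs % 2 ≟ 0

odd? : (xs : List ℕ) → Dec (length xs % 2 ≡ 1)
odd? xs = length xs % 2 ≟ 1

evens-odds≡sumℤ : ∀ L → + length (filter even? L) - + length (filter odd? L) ≡
                        sumℤ (map (λ xs → alternating (length xs)) L)
evens-odds≡sumℤ []       = refl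
evens-odds≡sumℤ (xs ∷ L) with alternating-parity (length xs)
... | inj₁ (even , alt≡1) =
  trans (cong₂ (λ es os → + length es - + length os)
               (Listₚ.filter-accept even? {x = xs} {xs = L} even)
               (Listₚ.filter-reject odd? {x = xs} {xs = L} (λ odd → ℕₚ.0≢1+n (trans (sym even) odd))))
        (trans (regroup e o) (cong₂ _+_ (sym alt≡1) (evens-odds≡sumℤ L)))
  where
  e o : ℤ
  e = + length (filter even? L)
  o = + length (filter odd? L)
  regroup : ∀ e o → (+ 1 + e) - o ≡ + 1 + (e - o)
  regroup = solve-∀
... | inj₂ (odd , alt≡-1) =
  trans (cong₂ (λ es os → + length es - + length os)
               (Listₚ.filter-reject even? {x = xs} {xs = L} (λ even → ℕₚ.0≢1+n (trans (sym even) odd)))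
               (Listₚ.filter-accept odd? {x = xs} {xs = L} odd))
        (trans (regroup e o) (cong₂ _+_ (sym alt≡-1) (evens-odds≡sumℤ L)))
  where
  e o : ℤ
  e = + length (filter even? L)
  o = + length (filter odd? L)
  regroup : ∀ e o → e - (+ 1 + o) ≡ - + 1 + (e - o)
  regroup = solve-∀

AtMost : ℕ → List ℕ → Set
AtMost α xs = All (λ a → occ a xs ≤ α) xs

atMost? : ∀ α xs → Dec (AtMost α xs)
atMost? α xs = All.all? (λ a → occ a xs ≤? α) xs

module _ (α a : ℕ) where

  atMost-replicate-++⁻ : ∀ c ys → All (_≢ a) ys → AtMost α (replicate c a ++ ys) → c ≤ α × AtMost α ys
  atMost-replicate-++⁻ zero    ys ys≢a ys≤α         = z≤n , ys≤α
  atMost-replicate-++⁻ (suc c) ys ys≢a (occ≤α ∷ xs≤α) =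
    subst (_≤ α) (occ-replicate-++ a (suc c) ys ys≢a) occ≤α ,
    All.zipWith (λ (occ≤α , y≢a) → subst (_≤ α) (occ-replicate-++-≢ a (suc c) ys y≢a) occ≤α)
                (Allₚ.++⁻ʳ (replicate c a) xs≤α , ys≢a)

  atMost-replicate-++⁺ : ∀ c ys → All (_≢ a) ys → c ≤ α → AtMost α ys → AtMost α (replicate c a ++ ys)
  atMost-replicate-++⁺ c ys ys≢a c≤α ys≤α =
    Allₚ.++⁺ (Allₚ.replicate⁺ c (subst (_≤ α) (sym (occ-replicate-++ a c ys ys≢a)) c≤α))
             (All.zipWith (λ (occ≤α , y≢a) → subst (_≤ α) (sym (occ-replicate-++-≢ a c ys y≢a)) occ≤α)
                          (ys≤α , ys≢a))

  atMost-weight : ∀ c ys → All (_≢ a) ys →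
                  (if ⌊ atMost? α (replicate c a ++ ys) ⌋ then + 1 else + 0) ≡
                  truncGeometric α c * (if ⌊ atMost? α ys ⌋ then + 1 else + 0)
  atMost-weight c ys ys≢a with atMost? α (replicate c a ++ ys) | c ≤? α | atMost? α ys
  ... | yes _    | yes _   | yes _    = refl
  ... | yes xs≤α | no c≰α  | _        = contradiction (proj₁ (atMost-replicate-++⁻ c ys ys≢a xs≤α)) c≰α
  ... | yes xs≤α | yes _   | no ys≰α  = contradiction (proj₂ (atMost-replicate-++⁻ c ys ys≢a xs≤α)) ys≰α
  ... | no xs≰α  | yes c≤α | yes ys≤α = contradiction (atMost-replicate-++⁺ c ys ys≢a c≤α ys≤α) xs≰α
  ... | no _     | yes _   | no _     = refl
  ... | no _     | no _    | _        = refl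

EvenPartition↔ : ∀ {A m} → EvenPartition A m ↔ Σ (Partition A m) (λ x → length (parts x) % 2 ≡ 0)
EvenPartition↔ = mk↔ₛ′ (λ y → EvenPartition.partition y , EvenPartition.even y)
                       (λ (x , e) → record { partition = x ; even = e }) (λ _ → refl) (λ _ → refl)

OddPartition↔ : ∀ {A m} → OddPartition A m ↔ Σ (Partition A m) (λ x → length (parts x) % 2 ≡ 1)
OddPartition↔ = mk↔ₛ′ (λ y → OddPartition.partition y , OddPartition.odd y)
                      (λ (x , o) → record { partition = x ; odd = o }) (λ _ → refl) (λ _ → refl)

PartitionAtMost↔ : ∀ {A α m} → PartitionAtMost A α m ↔ Σ (Partition A m) (λ x → AtMost α (parts x))
PartitionAtMost↔ = mk↔ₛ′ (λ y → PartitionAtMost.partition y , PartitionAtMost.mult y)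
                         (λ (x , q) → mkPartitionAtMost x q) (λ _ → refl) (λ _ → refl)

module Counting (ψ : ℕ → ℕ) (ψ-injective : Injective _≡_ _≡_ ψ) (p : ℕ → ℕ)
                (p-card : ∀ m → HasCard (Partition (Img ψ) m) (p m)) (n : ℕ) where

  A : ℕ → Set
  A = Img ψ

  -- The only use of injectivity: it makes the witness of a ∈ ψ(ℕ) unique, so that a partition
  -- is determined by its list of parts.
  A-irrelevant : ∀ {a} (u v : A a) → u ≡ v
  A-irrelevant (i , ψi≡a) (j , ψj≡a) with ψ-injective (trans ψi≡a (sym ψj≡a))
  ... | refl = cong (i ,_) (ℕₚ.≡-irrelevant ψi≡a ψj≡a)

  parts-injective : ∀ {m} → Injective _≡_ _≡_ (parts {A} {m})
  parts-injective {x = mkPartition xs xs↓ xs>0 xs∈A ∑xs} {mkPartition .xs xs↓′ xs>0′ xs∈A′ ∑xs′} refl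
    with Linked.irrelevant ℕₚ.≤-irrelevant xs↓ xs↓′ | All.irrelevant ℕₚ.≤-irrelevant xs>0 xs>0′
       | All.irrelevant A-irrelevant xs∈A xs∈A′ | ℕₚ.≡-irrelevant ∑xs ∑xs′
  ... | refl | refl | refl | refl = refl

  -- A need not be decidable in general, but a ∈ A iff the singleton [a] occurs in the
  -- finite enumeration of the partitions of a given by p-card.
  A? : ∀ b → Dec (A (suc b))
  A? b with Finₚ.any? (λ i → Listₚ.≡-dec _≟_ (parts (Inverse.to (p-card (suc b)) i)) (suc b ∷ []))
  ... | yes (i , parts≡[b+1]) = yes (All.head (subst (All A) parts≡[b+1] (inA (Inverse.to (p-card (suc b)) i))))
  ... | no no-singleton = no λ b+1∈A →
    no-singleton (Inverse.from (p-card (suc b)) (singleton b+1∈A) ,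
                  cong parts (Inverse.strictlyInverseˡ (p-card (suc b)) (singleton b+1∈A)))
    where
    singleton : A (suc b) → Partition A (suc b)
    singleton b+1∈A = mkPartition (suc b ∷ []) [-] (s≤s z≤n ∷ []) (b+1∈A ∷ []) (ℕₚ.+-identityʳ (suc b))

  S : List ℕ
  S = filter A? (downFrom n)

  S-decreasing : AllPairs _>_ S
  S-decreasing = AllPairsₚ.filter⁺ A? (AllPairsₚ.applyDownFrom⁺₁ (λ i → i) n (λ j<i _ → j<i))

  isPart⇒A : ∀ {x} → IsPart S x → A x
  isPart⇒A x∈S with find x∈S
  ... | _ , b∈S , refl = proj₂ (∈ₚ.∈-filter⁻ A? {xs = downFrom n} b∈S)

  parts-isPart : ∀ {m} → m ≤ n → (x : Partition A m) → All (IsPart S) (parts x)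
  parts-isPart m≤n x = All.zipWith isPart (All.zipWith (λ z → z) (pos x , inA x) , All-≤-sum (parts x))
    where
    isPart : ∀ {y} → (1 ≤ y × A y) × y ≤ sum (parts x) → IsPart S y
    isPart {suc b} ((_ , b+1∈A) , b+1≤∑) =
      lose (∈ₚ.∈-filter⁺ A? (∈ₚ.∈-downFrom⁺ b<n) b+1∈A) refl
      where
      b<n : b < n
      b<n = ℕₚ.≤-trans b+1≤∑ (ℕₚ.≤-trans (ℕₚ.≤-reflexive (total x)) m≤n)

  toPartition : ∀ {m xs} → IsPartition S m xs → Partition A m
  toPartition {xs = xs} (xs↓ , xsParts , ∑xs≡m) =
    mkPartition xs xs↓ (All.map isPart-pos xsParts) (All.map isPart⇒A xsParts) ∑xs≡m

  partitions-complete : ∀ {m} → m ≤ n → (x : Partition A m) → parts x ∈ partitionsInto S m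
  partitions-complete m≤n x =
    partitionsInto-complete S S-decreasing _ (nonincr x , parts-isPart m≤n x , total x)

  partitions-card : ∀ {m} → m ≤ n → HasCard (Partition A m) (length (partitionsInto S m))
  partitions-card {m} m≤n =
    hasCard-enumeration parts parts-injective (partitionsInto S m) (partitionsInto-unique S S-decreasing m)
      (partitions-complete m≤n) (λ xs xs∈ → toPartition (partitionsInto-sound S S-decreasing m xs∈))
      (λ _ _ → refl)

  partitionsWith-card : ∀ {Q : List ℕ → Set} (Q? : ∀ xs → Dec (Q xs)) → (∀ {xs} (u v : Q xs) → u ≡ v) →
                        ∀ {m} → m ≤ n →
                        HasCard (Σ (Partition A m) (λ x → Q (parts x))) (length (filter Q? (partitionsInto S m)))
  partitionsWith-card {Q} Q? Q-irrelevant {m} m≤n =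
    hasCard-enumeration (λ (x , _) → parts x) code-injective (filter Q? (partitionsInto S m))
      (Uniqueₚ.filter⁺ Q? (partitionsInto-unique S S-decreasing m))
      (λ (x , q) → ∈ₚ.∈-filter⁺ Q? (partitions-complete m≤n x) q)
      (λ xs xs∈ → let xs∈′ , q = ∈ₚ.∈-filter⁻ Q? {xs = partitionsInto S m} xs∈
                  in toPartition (partitionsInto-sound S S-decreasing m xs∈′) , q)
      (λ _ _ → refl)
    where
    code-injective : Injective _≡_ _≡_ (λ ((x , _) : Σ (Partition A m) (λ x → Q (parts x))) → parts x)
    code-injective {x , q} {y , r} parts≡ with parts-injective {x = x} {y} parts≡
    ... | refl = cong (x ,_) (Q-irrelevant q r)

  count-filter : ∀ {Q : List ℕ → Set} (Q? : ∀ xs → Dec (Q xs)) → (∀ {xs} (u v : Q xs) → u ≡ v) →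
                 ∀ {m Y k} → m ≤ n → HasCard Y k → Y ↔ Σ (Partition A m) (λ x → Q (parts x)) →
                 k ≡ length (filter Q? (partitionsInto S m))
  count-filter Q? Q-irrelevant m≤n Y-card Y↔Σ =
    hasCard-unique (↔-trans Y-card Y↔Σ) (partitionsWith-card Q? Q-irrelevant m≤n)

  p≡prodDilate : ∀ {m} → m ≤ n → + p m ≡ prodDilate S geometric m
  p≡prodDilate {m} m≤n = begin
    + p m                                        ≡⟨ cong +_ (hasCard-unique (p-card m) (partitions-card m≤n)) ⟩
    + length (partitionsInto S m)                ≡⟨ +length≡sumℤ (partitionsInto S m) ⟩
    sumℤ (map (λ _ → + 1) (partitionsInto S m))  ≡⟨ sumℤ-partitionsInto (λ _ → + 1) geometric refl
                                                      (λ _ _ _ _ → refl) S S-decreasing m ⟩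
    prodDilate S geometric m                     ∎
    where open ≡-Reasoning

  E-O≡prodDilate : (E O : ℕ → ℕ) → (∀ m → HasCard (EvenPartition A m) (E m)) →
                   (∀ m → HasCard (OddPartition A m) (O m)) →
                   ∀ {m} → m ≤ n → + E m - + O m ≡ prodDilate S alternating m
  E-O≡prodDilate E O E-card O-card {m} m≤n = begin
    + E m - + O m
      ≡⟨ cong₂ (λ e o → + e - + o) (count-filter even? ℕₚ.≡-irrelevant m≤n (E-card m) EvenPartition↔)
                                   (count-filter odd? ℕₚ.≡-irrelevant m≤n (O-card m) OddPartition↔) ⟩
    + length (filter even? (partitionsInto S m)) - + length (filter odd? (partitionsInto S m))
      ≡⟨ evens-odds≡sumℤ (partitionsInto S m) ⟩
    sumℤ (map (λ xs → alternating (length xs)) (partitionsInto S m))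
      ≡⟨ sumℤ-partitionsInto (λ xs → alternating (length xs)) alternating refl alternating-weight
                             S S-decreasing m ⟩
    prodDilate S alternating m ∎
    where
    open ≡-Reasoning
    alternating-weight : ∀ a c ys → All (_≢ a) ys →
                         alternating (length (replicate c a ++ ys)) ≡ alternating c * alternating (length ys)
    alternating-weight a c ys _ =
      trans (cong alternating (trans (Listₚ.length-++ (replicate c a))
                                     (cong (ℕ._+ length ys) (Listₚ.length-replicate c))))
            (alternating-+ c (length ys))

  pα≡prodDilate : ∀ α {pα} → HasCard (PartitionAtMost A α n) pα →
                  + pα ≡ prodDilate S (truncGeometric α) n
  pα≡prodDilate α {pα} pα-card = begin
    + pα
      ≡⟨ cong +_ (count-filter (atMost? α) (All.irrelevant ℕₚ.≤-irrelevant) ℕₚ.≤-refl pα-card PartitionAtMost↔) ⟩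
    + length (filter (atMost? α) (partitionsInto S n))
      ≡⟨ +length-filter≡sumℤ (atMost? α) (partitionsInto S n) ⟩
    sumℤ (map (λ xs → if ⌊ atMost? α xs ⌋ then + 1 else + 0) (partitionsInto S n))
      ≡⟨ sumℤ-partitionsInto _ (truncGeometric α) refl (atMost-weight α) S S-decreasing n ⟩
    prodDilate S (truncGeometric α) n ∎
    where open ≡-Reasoning

mainTheorem3 : (ψ : ℕ → ℕ) → Injective _≡_ _≡_ ψ →
  (p E O : ℕ → ℕ) →
  (∀ m → HasCard (Partition (Img ψ) m) (p m)) →
  (∀ m → HasCard (EvenPartition (Img ψ) m) (E m)) →
  (∀ m → HasCard (OddPartition (Img ψ) m) (O m)) →
  (n α : ℕ) → 1 ≤ α → (pα : ℕ) →
  HasCard (PartitionAtMost (Img ψ) α n) pα →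
  + pα ≡ sumTo n (λ i → + p (n ∸ i) * Gamma (λ N → + E N - + O N) α i)
mainTheorem3 ψ ψ-injective p E O p-card E-card O-card n α _ pα pα-card = begin
  + pα
    ≡⟨ pα≡prodDilate α pα-card ⟩
  prodDilate S (truncGeometric α) n
    ≡⟨ prodDilate-truncGeometric S α n ⟩
  (dilate α D ⋆ prodDilate S geometric) n
    ≡⟨ ⋆-as-sum (dilate α D) (prodDilate S geometric) n ⟩
  sumBelow (suc n) (λ i → dilate α D i * prodDilate S geometric (n ∸ i))
    ≡⟨ sumBelow-cong (suc n) (λ i i≤n →
         trans (ℤₚ.*-comm (dilate α D i) (prodDilate S geometric (n ∸ i)))
               (cong₂ _*_ (sym (p≡prodDilate (ℕₚ.m∸n≤m n i))) (sym (Γ≡ α i (ℕₚ.≤-pred i≤n))))) ⟩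
  sumBelow (suc n) (λ i → + p (n ∸ i) * Gamma pbar α i)
    ≡⟨ sumℤ-upTo (λ i → + p (n ∸ i) * Gamma pbar α i) (suc n) ⟨
  sumTo n (λ i → + p (n ∸ i) * Gamma pbar α i) ∎
  where
  open ≡-Reasoning
  open Counting ψ ψ-injective p p-card n
  pbar : Series
  pbar N = + E N - + O N
  D : Series
  D = prodDilate S (oneMinusXPow 1)
  Γ≡ : ∀ α i → i ≤ n → Gamma pbar α i ≡ dilate α D i
  Γ≡ = Gamma≡dilate pbar (prodDilate S alternating) D n (λ N → E-O≡prodDilate E O E-card O-card)
                    (prodDilate-oneMinusX S) (prodDilate-zero S (oneMinusXPow 1) refl)
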